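{- If $P(x_1,\dots,x_n)$ is a homogeneous partition regular polynomial, then $\mathrm{Red}(P)$ is partition regular.
   Context: Polynomials have integer coefficients, are in normal reduced form, have constant term $0$, and $x_1,\dots,x_n$ are exactly the variables occurring in $P$. If $P=\sum_{i=1}^ka_iM_i$ with $M_1,\dots,M_k$ its distinct monomials (each with leading coefficient 1) and $a_i\in\mathbb{Z}\setminus\{0\}$, the reduct is $\mathrm{Red}(P)(y_1,\dots,y_k)=\sum_{i=1}^ka_iy_i$. A polynomial $Q(z_1,\dots,z_r)$ is partition regular (on $\mathbb{N}$) if for every finite partition of $\mathbb{N}$ some piece contains nonzero $b_1,\dots,b_r$ (not necessarily distinct) with $Q(b_1,\dots,b_r)=0$. -}

module Defs where

open import Data.Nat using (ℕ; zero; suc)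
import Data.Nat as N
open import Data.Integer using (ℤ; +_; _+_; _*_; _^_)
open import Data.Fin using (Fin; zero; suc)
import Data.Fin as F
open import Data.Product using (Σ; ∃; ∃-syntax; _×_; _,_)
open import Relation.Binary.PropositionalEquality using (_≡_; _≢_)
open import Relation.Nullary using (yes; no)

∑ : ∀ {m} → (Fin m → ℤ) → ℤ
∑ {zero}  f = + 0
∑ {suc m} f = f zero + ∑ (λ i → f (suc i))

∏ : ∀ {m} → (Fin m → ℤ) → ℤ
∏ {zero}  f = + 1
∏ {suc m} f = f zero * ∏ (λ i → f (suc i))

∑ℕ : ∀ {m} → (Fin m → ℕ) → ℕ
∑ℕ {zero}  f = 0
∑ℕ {suc m} f = f zero N.+ ∑ℕ (λ i → f (suc i))

-- A polynomial in variables x_0..x_{n-1} with integer coefficients,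
-- given as a list of k terms a_i * M_i, M_i given by its exponent vector.
record Poly (n : ℕ) : Set where
  field
    k     : ℕ
    coeff : Fin k → ℤ
    mono  : Fin k → Fin n → ℕ

open Poly public

eval : ∀ {n} → Poly n → (Fin n → ℤ) → ℤ
eval P b = ∑ (λ i → coeff P i * ∏ (λ j → b j ^ mono P i j))

-- Normal reduced form, constant term 0, and x_1..x_n exactly the variables occurring
record NormalForm {n} (P : Poly n) : Set where
  field
    coeff≢0   : ∀ i → coeff P i ≢ + 0
    distinct  : ∀ i i′ → i ≢ i′ → ∃[ j ] (mono P i j ≢ mono P i′ j)
    nonconst  : ∀ i → ∃[ j ] (mono P i j ≢ 0)
    allOccur  : ∀ j → ∃[ i ] (mono P i j ≢ 0)

deg : ∀ {n} → (Fin n → ℕ) → ℕ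
deg e = ∑ℕ e

Homogeneous : ∀ {n} → Poly n → Set
Homogeneous P = ∃[ d ] (∀ i → deg (mono P i) ≡ d)

PartitionRegular : ∀ {n} → Poly n → Set
PartitionRegular {n} P =
  ∀ (r : ℕ) (c : ℕ → Fin r) →
    Σ (Fin n → ℕ) λ b → ((∀ j → b j ≢ 0)
           × (Σ (Fin r) λ col → (∀ j → c (b j) ≡ col))
           × eval P (λ j → + (b j)) ≡ + 0)

-- Reduct: Red(P)(y_1..y_k) = Σ a_i y_i, a polynomial in k variables
unitExp : ∀ {k} → Fin k → Fin k → ℕ
unitExp i j with i F.≟ j
... | yes _ = 1
... | no  _ = 0

Red : ∀ {n} (P : Poly n) → Poly (k P)
Red P = record { k = k P ; coeff = coeff P ; mono = unitExp }

-- Red P is a linear form, and a linear form is partition regular as soon as it satisfies Rado's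
-- columns condition: some coefficients, one of them a nonzero a, sum to zero. Putting u on a, v on
-- the rest of that set and w on the complement, whose coefficients sum to A, leaves
-- (u - v) a + w A = 0, and van der Waerden's theorem gives it monochromatic solutions with
-- u, v ∈ {x, x + ∣ A ∣ d} and w = ∣ a ∣ d. A homogeneous partition regular P satisfies the columns
-- condition by a p-adic argument in a monochromatic solution for the colouring by lowest nonzero
-- base-p digit, p a prime exceeding the sum of the absolute values of the coefficients.
module Submission where

open import Defs

module VanDerWaerden where

  open import Data.Nat
  open import Data.Nat.Properties
  open import Data.Nat.Tactic.RingSolver using (solve-∀)
  open import Data.Fin as Fin using (Fin; zero; suc; toℕ; fromℕ<; funToFin)
  import Data.Fin.Properties as Finₚ
  open import Data.Product
  open import Data.Sum using (_⊎_; inj₁; inj₂; [_,_]′)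
  open import Data.Empty using (⊥-elim)
  open import Function using (_∘_; id)
  open import Relation.Nullary using (¬_; yes; no)
  open import Relation.Binary.PropositionalEquality

  Colouring : ℕ → Set
  Colouring r = ℕ → Fin r

  -- fits asks that even the next term start + (k + 1) step be at most N.
  record MonochromaticAP {r} (c : Colouring r) (k N : ℕ) : Set where
    constructor mkAP
    field
      start step    : ℕ
      step≥1        : 1 ≤ step
      fits          : start + suc k * step ≤ N
      monochromatic : ∀ i → i ≤ k → c (start + i * step) ≡ c start

  VdWBound : (k r : ℕ) → Set
  VdWBound k r = ∃[ N ] ∀ (c : Colouring r) → MonochromaticAP c k N

  module _ {r} {c : Colouring r} {k : ℕ} where

    ap-weaken : ∀ {N N′} → N ≤ N′ → MonochromaticAP c k N → MonochromaticAP c k N′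
    ap-weaken N≤N′ (mkAP a d d≥1 fits mono) = mkAP a d d≥1 (≤-trans fits N≤N′) mono

    ap-shift : ∀ o {N} → MonochromaticAP (c ∘ (o +_)) k N → MonochromaticAP c k (o + N)
    ap-shift o (mkAP a d d≥1 fits mono) = mkAP (o + a) d d≥1 fits′ mono′
      where
      fits′ : o + a + suc k * d ≤ o + _
      fits′ = ≤-trans (≤-reflexive (+-assoc o a _)) (+-monoʳ-≤ o fits)
      mono′ : ∀ i → i ≤ k → c (o + a + i * d) ≡ c (o + a)
      mono′ i i≤k = trans (cong c (+-assoc o a (i * d))) (mono i i≤k)

  ap-step≤ : ∀ {r} {c : Colouring r} {k N} (P : MonochromaticAP c k N) →
             MonochromaticAP.step P ≤ N
  ap-step≤ {k = k} (mkAP a d _ fits _) = ≤-trans (≤-trans (m≤m+n d (k * d)) (m≤n+m _ a)) fits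

  ap-term< : ∀ {r} {c : Colouring r} {k N} (P : MonochromaticAP c k N) →
             ∀ i → i ≤ k → MonochromaticAP.start P + i * MonochromaticAP.step P < N
  ap-term< (mkAP a d@(suc _) _ fits _) i i≤k = <-≤-trans (+-monoʳ-< a (*-monoˡ-< d (s≤s i≤k))) fits

  blockColouring : ∀ {r} → Colouring r → (w : ℕ) → Colouring (r ^ w)
  blockColouring c w b = funToFin {w} (λ j → c (b * w + toℕ j))

  funToFin-injective : ∀ {m n} (f g : Fin m → Fin n) → funToFin f ≡ funToFin g → ∀ i → f i ≡ g i
  funToFin-injective {suc m} f g eq zero =
    proj₁ (Finₚ.combine-injective (f zero) (funToFin (f ∘ suc)) (g zero) (funToFin (g ∘ suc)) eq)
  funToFin-injective {suc m} f g eq (suc i) = funToFin-injective (f ∘ suc) (g ∘ suc)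
    (proj₂ (Finₚ.combine-injective (f zero) (funToFin (f ∘ suc)) (g zero) (funToFin (g ∘ suc)) eq)) i

  blockColouring-injective : ∀ {r} (c : Colouring r) w {b b′} →
    blockColouring c w b ≡ blockColouring c w b′ → ∀ j → j < w → c (b * w + j) ≡ c (b′ * w + j)
  blockColouring-injective c w {b} {b′} eq j j<w =
    subst (λ j′ → c (b * w + j′) ≡ c (b′ * w + j′)) (Finₚ.toℕ-fromℕ< j<w)
          (funToFin-injective {w} _ _ eq (fromℕ< j<w))

  record Fan {r} (c : Colouring r) (k N s : ℕ) : Set where
    field
      focus         : ℕ
      focus<N       : focus < N
      start step    : Fin s → ℕ
      step≥1        : ∀ t → 1 ≤ step t
      reaches       : ∀ t → start t + suc k * step t ≡ focus
      monochromatic : ∀ t i → i ≤ k → c (start t + i * step t) ≡ c (start t)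
      distinct      : ∀ t t′ → c (start t) ≡ c (start t′) → t ≡ t′

  record ColourFocused {r} (c : Colouring r) (k N s : ℕ) : Set where
    field
      fan   : Fan c k N s
      fresh : ∀ t → c (Fan.focus fan) ≢ c (Fan.start fan t)
    open Fan fan public

  term-suc : ∀ a k d → a + suc (suc k) * d ≡ a + suc k * d + d
  term-suc = solve-∀

  module _ {r} {c : Colouring r} {k N s} (F : Fan c k N s) where
    open Fan F

    fan-close : ∀ t → c focus ≡ c (start t) → MonochromaticAP c (suc k) (focus + step t)
    fan-close t eq = mkAP (start t) (step t) (step≥1 t) fits coloured
      where
      fits : start t + suc (suc k) * step t ≤ focus + step t
      fits = ≤-reflexive (trans (term-suc (start t) k (step t)) (cong (_+ step t) (reaches t)))
      coloured : ∀ i → i ≤ suc k → c (start t + i * step t) ≡ c (start t)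
      coloured i i≤1+k with m≤n⇒m<n∨m≡n i≤1+k
      ... | inj₁ (s≤s i≤k) = monochromatic t i i≤k
      ... | inj₂ refl      = trans (cong c (reaches t)) eq

    fan-or-ap : ∀ {N′} → (∀ t → focus + step t ≤ N′) →
                MonochromaticAP c (suc k) N′ ⊎ ColourFocused c k N s
    fan-or-ap bound with Finₚ.any? (λ t → c focus Fin.≟ c (start t))
    ... | yes (t , eq) = inj₁ (ap-weaken (bound t) (fan-close t eq))
    ... | no  new      = inj₂ (record { fan = F ; fresh = λ t eq → new (t , eq) })

  focused-with-all-colours : ∀ {r} {c : Colouring r} {k N} → ¬ ColourFocused c k N r
  focused-with-all-colours {r} {c} F with Finₚ.pigeonhole (n<1+n r) colour
    where
    open ColourFocused F
    colour : Fin (suc r) → Fin r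
    colour zero    = c focus
    colour (suc t) = c (start t)
  ... | zero  , zero   , () , _
  ... | suc _ , zero   , () , _
  ... | zero  , suc t  , _  , eq = ColourFocused.fresh F t eq
  ... | suc t , suc t′ , t<t′ , eq =
    <-irrefl (cong (toℕ ∘ suc) (ColourFocused.distinct F t t′ eq)) t<t′

  FocusedOrAP : (k r s : ℕ) → Set
  FocusedOrAP k r s = ∃[ N ] ∀ (c : Colouring r) → MonochromaticAP c (suc k) N ⊎ ColourFocused c k N s

  focusedOrAP-zero : ∀ k r → FocusedOrAP k r 0
  focusedOrAP-zero k r = 1 , λ c → inj₂ (record { fan = emptyFan ; fresh = λ () })
    where
    emptyFan : ∀ {c : Colouring r} → Fan c k 1 0
    emptyFan = record { focus = 0 ; focus<N = s≤s z≤n ; start = λ () ; step = λ ()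
                      ; step≥1 = λ () ; reaches = λ () ; monochromatic = λ () ; distinct = λ () }

  block-shift : ∀ b K D w j → b * w + j + K * (D * w) ≡ (b + K * D) * w + j
  block-shift = solve-∀

  block-shift-step : ∀ b K D w j e → b * w + j + K * (e + D * w) ≡ (b + K * D) * w + (j + K * e)
  block-shift-step = solve-∀

  -- Colour each block of width w by its whole colouring and take a monochromatic progression of
  -- k + 1 blocks b₀ + i D. The block fan of block b₀, moved along the progression of blocks, and the
  -- progression of its focus together form a fan of s + 1 progressions focused in block b₀ + (k + 1) D.
  module FocusingStep (k r : ℕ) (vdW-k : ∀ R → VdWBound k R) {s} (w : ℕ)
    (inBlock : ∀ (c : Colouring r) → MonochromaticAP c (suc k) w ⊎ ColourFocused c k w s) where

    M : ℕ
    M = proj₁ (vdW-k (r ^ w))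

    N′ : ℕ
    N′ = suc M * w + suc M * w

    block-end : ∀ {b} → b ≤ M → b * w + w ≤ suc M * w
    block-end {b} b≤M = begin
      b * w + w  ≡⟨ +-comm (b * w) w ⟩
      suc b * w  ≤⟨ *-monoˡ-≤ w (s≤s b≤M) ⟩
      suc M * w  ∎
      where open ≤-Reasoning

    in-block : ∀ {b j} → b ≤ M → j < w → b * w + j < suc M * w
    in-block {b} b≤M j<w = ≤-trans (+-monoʳ-< (b * w) j<w) (block-end b≤M)

    module _ (c : Colouring r) where

      blocks : MonochromaticAP (blockColouring c w) k M
      blocks = proj₂ (vdW-k (r ^ w)) (blockColouring c w)

      open MonochromaticAP blocks
        renaming (start to b₀; step to D; step≥1 to D≥1; fits to blocks-fit; monochromatic to blocks-mono)

      sameBlocks : ∀ i → i ≤ k → ∀ j → j < w → c ((b₀ + i * D) * w + j) ≡ c (b₀ * w + j)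
      sameBlocks i i≤k = blockColouring-injective c w {b₀ + i * D} {b₀} (blocks-mono i i≤k)

      c₀ : Colouring r
      c₀ = c ∘ (b₀ * w +_)

      b₀≤M : b₀ ≤ M
      b₀≤M = ≤-trans (m≤m+n b₀ _) blocks-fit

      D≤M : D ≤ M
      D≤M = ap-step≤ blocks

      liftAP : MonochromaticAP c₀ (suc k) w → MonochromaticAP c (suc k) N′
      liftAP ap = ap-weaken (≤-trans (block-end b₀≤M) (m≤m+n _ _)) (ap-shift (b₀ * w) ap)

      module _ (F : ColourFocused c₀ k w s) where
        open ColourFocused F renaming (focus to f; start to A; step to E; focus<N to f<w)

        term<w : ∀ t i → i ≤ k → A t + i * E t < w
        term<w t i i≤k = ≤-<-trans (+-monoʳ-≤ (A t) (*-monoˡ-≤ (E t) (m≤n⇒m≤1+n i≤k)))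
                                   (subst (_< w) (sym (reaches t)) f<w)

        E<w : ∀ t → E t < w
        E<w t = ≤-<-trans (≤-trans (m≤m+n (E t) _) (m≤n+m _ (A t)))
                          (subst (_< w) (sym (reaches t)) f<w)

        focus′ : ℕ
        focus′ = (b₀ + suc k * D) * w + f

        start′ step′ : Fin (suc s) → ℕ
        start′ zero    = b₀ * w + f
        start′ (suc t) = b₀ * w + A t
        step′ zero     = D * w
        step′ (suc t)  = E t + D * w

        focus′<sucMw : focus′ < suc M * w
        focus′<sucMw = in-block blocks-fit f<w

        step′≤sucMw : ∀ t → step′ t ≤ suc M * w
        step′≤sucMw zero    = ≤-trans (*-monoˡ-≤ w D≤M) (m≤n+m _ w)
        step′≤sucMw (suc t) = +-mono-≤ (<⇒≤ (E<w t)) (*-monoˡ-≤ w D≤M)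

        step′≥1 : ∀ t → 1 ≤ step′ t
        step′≥1 zero    = *-mono-≤ D≥1 (≤-trans (s≤s z≤n) f<w)
        step′≥1 (suc t) = ≤-trans (step≥1 t) (m≤m+n _ _)

        reaches′ : ∀ t → start′ t + suc k * step′ t ≡ focus′
        reaches′ zero    = block-shift b₀ (suc k) D w f
        reaches′ (suc t) = trans (block-shift-step b₀ (suc k) D w (A t) (E t))
                                 (cong ((b₀ + suc k * D) * w +_) (reaches t))

        monochromatic′ : ∀ t i → i ≤ k → c (start′ t + i * step′ t) ≡ c (start′ t)
        monochromatic′ zero i i≤k =
          trans (cong c (block-shift b₀ i D w f)) (sameBlocks i i≤k f f<w)
        monochromatic′ (suc t) i i≤k = begin
          c (b₀ * w + A t + i * (E t + D * w))  ≡⟨ cong c (block-shift-step b₀ i D w (A t) (E t)) ⟩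
          c ((b₀ + i * D) * w + (A t + i * E t)) ≡⟨ sameBlocks i i≤k _ (term<w t i i≤k) ⟩
          c₀ (A t + i * E t)                     ≡⟨ monochromatic t i i≤k ⟩
          c₀ (A t)                               ∎
          where open ≡-Reasoning

        distinct′ : ∀ t t′ → c (start′ t) ≡ c (start′ t′) → t ≡ t′
        distinct′ zero    zero     _  = refl
        distinct′ zero    (suc t′) eq = ⊥-elim (fresh t′ eq)
        distinct′ (suc t) zero     eq = ⊥-elim (fresh t (sym eq))
        distinct′ (suc t) (suc t′) eq = cong suc (distinct t t′ eq)

        liftFan : Fan c k N′ (suc s)
        liftFan = record
          { focus = focus′ ; focus<N = ≤-trans focus′<sucMw (m≤m+n _ _)
          ; start = start′ ; step = step′ ; step≥1 = step′≥1 ; reaches = reaches′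
          ; monochromatic = monochromatic′ ; distinct = distinct′ }

        liftFan-fits : ∀ t → focus′ + step′ t ≤ N′
        liftFan-fits t = +-mono-≤ (<⇒≤ focus′<sucMw) (step′≤sucMw t)

      focusedOrAP : MonochromaticAP c (suc k) N′ ⊎ ColourFocused c k N′ (suc s)
      focusedOrAP with inBlock c₀
      ... | inj₁ ap = inj₁ (liftAP ap)
      ... | inj₂ F  = fan-or-ap (liftFan F) (liftFan-fits F)

  focusedOrAP-suc : ∀ k r → (∀ R → VdWBound k R) →
                    ∀ {s} → FocusedOrAP k r s → FocusedOrAP k r (suc s)
  focusedOrAP-suc k r vdW-k (w , inBlock) = FocusingStep.N′ k r vdW-k w inBlock
                                          , FocusingStep.focusedOrAP k r vdW-k w inBlock

  focusedOrAP : ∀ k r → (∀ R → VdWBound k R) → ∀ s → FocusedOrAP k r s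
  focusedOrAP k r vdW-k zero    = focusedOrAP-zero k r
  focusedOrAP k r vdW-k (suc s) = focusedOrAP-suc k r vdW-k (focusedOrAP k r vdW-k s)

  vanDerWaerden : ∀ k r → VdWBound k r
  vanDerWaerden zero    r = 1 , λ c → mkAP 0 1 ≤-refl ≤-refl (λ { .0 z≤n → refl })
  vanDerWaerden (suc k) r = N , λ c → [ id , ⊥-elim ∘ focused-with-all-colours ]′ (H c)
    where
    open Σ (focusedOrAP k r (vanDerWaerden k) r) renaming (proj₁ to N; proj₂ to H)

module RadoTriples where

  open import Data.Nat
  open import Data.Nat.Properties
  open import Data.Nat.Tactic.RingSolver using (solve-∀)
  open import Data.Fin as Fin using (Fin; zero; suc)
  import Data.Fin.Properties as Finₚ
  open import Data.Product
  open import Data.Empty using (⊥-elim)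
  open import Function using (_∘_)
  open import Relation.Nullary using (yes; no)
  open import Relation.Binary.PropositionalEquality
  open VanDerWaerden

  record RadoTriple {r} (c : Colouring r) (L M n : ℕ) : Set where
    constructor mkTriple
    field
      x d         : ℕ
      x≥1         : 1 ≤ x
      d≥1         : 1 ≤ d
      x+Ld≤n      : x + L * d ≤ n
      Md≤n        : M * d ≤ n
      colour-x+Ld : c (x + L * d) ≡ c x
      colour-Md   : c (M * d) ≡ c x

  -- The value of skip α at α itself is junk.
  skip : ∀ {r} → Fin (suc (suc r)) → Fin (suc (suc r)) → Fin (suc r)
  skip α β with α Fin.≟ β
  ... | yes _   = zero
  ... | no α≢β = Fin.punchOut α≢β

  skip-injective : ∀ {r} {α β γ : Fin (suc (suc r))} → α ≢ β → α ≢ γ → skip α β ≡ skip α γ → β ≡ γ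
  skip-injective {α = α} {β} {γ} α≢β α≢γ eq with α Fin.≟ β | α Fin.≟ γ
  ... | yes α≡β | _       = ⊥-elim (α≢β α≡β)
  ... | no _    | yes α≡γ = ⊥-elim (α≢γ α≡γ)
  ... | no α≢β′ | no α≢γ′ = Finₚ.punchOut-injective α≢β′ α≢γ′ eq

  scale-triple : ∀ s x L d → s * x + L * (s * d) ≡ s * (x + L * d)
  scale-triple = solve-∀

  scale-comm : ∀ s M d → M * (s * d) ≡ s * (M * d)
  scale-comm = solve-∀

  shifted-term : ∀ a L j D → suc a + L * (D * j) ≡ suc (a + (L * j) * D)
  shifted-term = solve-∀

  radoTriples-one : ∀ L M → ∃[ n ] ∀ (c : Colouring 1) → RadoTriple c L M n
  radoTriples-one L M = suc L + M , λ c → mkTriple 1 1 ≤-refl ≤-refl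
    (≤-trans (≤-reflexive (cong suc (*-identityʳ L))) (m≤m+n (suc L) M))
    (≤-trans (≤-reflexive (*-identityʳ M)) (m≤n+m M (suc L)))
    (one-colour _ _) (one-colour _ _)
    where
    one-colour : ∀ (i j : Fin 1) → i ≡ j
    one-colour zero zero = refl

  -- Take a monochromatic progression suc a + i D, i ≤ L m + 1, of colour α. Either some M D j with
  -- 1 ≤ j ≤ m has colour α, giving the triple (suc a, D j), or the colouring j ↦ c (M D j) avoids α
  -- on [1, m], and a triple for it with one colour fewer, scaled by M D, is a triple for c.
  module TripleStep (L M : ℕ) (M≥1 : 1 ≤ M) {r m : ℕ}
                    (triples : ∀ (c : Colouring (suc r)) → RadoTriple c L M m) where

    N : ℕ
    N = proj₁ (vanDerWaerden (suc (L * m)) (suc (suc r)))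

    n : ℕ
    n = N + M * N * m

    module _ (c : Colouring (suc (suc r))) where

      progression : MonochromaticAP (c ∘ suc) (suc (L * m)) N
      progression = proj₂ (vanDerWaerden (suc (L * m)) (suc (suc r))) (c ∘ suc)

      open MonochromaticAP progression renaming (start to a; step to D; step≥1 to D≥1)

      α : Fin (suc (suc r))
      α = c (suc a)

      s : ℕ
      s = M * D

      s≥1 : 1 ≤ s
      s≥1 = *-mono-≤ M≥1 D≥1

      scaled≤n : ∀ {y} → y ≤ m → s * y ≤ n
      scaled≤n y≤m = ≤-trans (*-mono-≤ (*-monoʳ-≤ M (ap-step≤ progression)) y≤m) (m≤n+m _ N)

      triple-hit : ∀ {j} → 1 ≤ j → j ≤ m → α ≡ c (s * j) → RadoTriple c L M n
      triple-hit {j} j≥1 j≤m α≡ = mkTriple (suc a) (D * j) (s≤s z≤n) (*-mono-≤ D≥1 j≥1)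
        (≤-trans (≤-reflexive (shifted-term a L j D))
                 (≤-trans (ap-term< progression (L * j) Lj≤) (m≤m+n N _)))
        (≤-trans (≤-reflexive (sym (*-assoc M D j))) (scaled≤n j≤m))
        (trans (cong c (shifted-term a L j D)) (monochromatic (L * j) Lj≤))
        (trans (cong c (sym (*-assoc M D j))) (sym α≡))
        where
        Lj≤ : L * j ≤ suc (L * m)
        Lj≤ = m≤n⇒m≤1+n (*-monoʳ-≤ L j≤m)

      module _ (avoid : ∀ {j} → 1 ≤ j → j ≤ m → α ≢ c (s * j)) where

        open RadoTriple (triples (λ y → skip α (c (s * y))))

        recover : ∀ {y z} → 1 ≤ y → y ≤ m → 1 ≤ z → z ≤ m →
                  skip α (c (s * y)) ≡ skip α (c (s * z)) → c (s * y) ≡ c (s * z)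
        recover y≥1 y≤m z≥1 z≤m = skip-injective (avoid y≥1 y≤m) (avoid z≥1 z≤m)

        x≤m : x ≤ m
        x≤m = ≤-trans (m≤m+n x (L * d)) x+Ld≤n

        triple-avoid : RadoTriple c L M n
        triple-avoid = mkTriple (s * x) (s * d) (*-mono-≤ s≥1 x≥1) (*-mono-≤ s≥1 d≥1)
          (≤-trans (≤-reflexive (scale-triple s x L d)) (scaled≤n x+Ld≤n))
          (≤-trans (≤-reflexive (scale-comm s M d)) (scaled≤n Md≤n))
          (trans (cong c (scale-triple s x L d))
                 (recover (≤-trans x≥1 (m≤m+n x _)) x+Ld≤n x≥1 x≤m colour-x+Ld))
          (trans (cong c (scale-comm s M d)) (recover (*-mono-≤ M≥1 d≥1) Md≤n x≥1 x≤m colour-Md))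

      triple : RadoTriple c L M n
      triple with anyUpTo? (λ j → α Fin.≟ c (s * suc j)) m
      ... | yes (j , j<m , α≡) = triple-hit (s≤s z≤n) j<m α≡
      ... | no none = triple-avoid λ { {suc j} _ j<m α≡ → none (j , j<m , α≡) }

  radoTriples : ∀ L M → 1 ≤ M → ∀ r → ∃[ n ] ∀ (c : Colouring (suc r)) → RadoTriple c L M n
  radoTriples L M M≥1 zero    = radoTriples-one L M
  radoTriples L M M≥1 (suc r) = TripleStep.n L M M≥1 triples , TripleStep.triple L M M≥1 triples
    where
    triples : ∀ (c : Colouring (suc r)) → RadoTriple c L M (proj₁ (radoTriples L M M≥1 r))
    triples = proj₂ (radoTriples L M M≥1 r)

module LinearEquations where

  open import Data.Nat as ℕ using (ℕ; zero; suc)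
  import Data.Nat.Properties as ℕₚ
  open import Data.Integer as ℤ using (ℤ; +_; -[1+_]; _+_; _*_; _-_; -_; ∣_∣; _^_)
  import Data.Integer.Properties as ℤₚ
  open import Data.Integer.Tactic.RingSolver using (solve-∀)
  open import Data.Fin as Fin using (Fin; zero; suc)
  import Data.Fin.Properties as Finₚ
  open import Data.Bool using (Bool; true; false; not; if_then_else_)
  open import Data.Product
  open import Data.Sum as Sum using (_⊎_; inj₁; inj₂; [_,_]′)
  open import Data.Empty using (⊥-elim)
  open import Function using (_∘_)
  open import Relation.Nullary using (yes; no; does)
  open import Relation.Binary.PropositionalEquality
  open import Algebra.Properties.CommutativeSemigroup ℤₚ.+-commutativeSemigroup
    using () renaming (interchange to +-interchange)
  open VanDerWaerden using (Colouring)
  open RadoTriples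

  ∑-cong : ∀ {m} {f g : Fin m → ℤ} → (∀ i → f i ≡ g i) → ∑ f ≡ ∑ g
  ∑-cong {zero}  f≗g = refl
  ∑-cong {suc m} f≗g = cong₂ _+_ (f≗g zero) (∑-cong (λ i → f≗g (suc i)))

  ∏-cong : ∀ {m} {f g : Fin m → ℤ} → (∀ i → f i ≡ g i) → ∏ f ≡ ∏ g
  ∏-cong {zero}  f≗g = refl
  ∏-cong {suc m} f≗g = cong₂ _*_ (f≗g zero) (∏-cong (λ i → f≗g (suc i)))

  ∑-distrib-+ : ∀ {m} (f g : Fin m → ℤ) → ∑ (λ i → f i + g i) ≡ ∑ f + ∑ g
  ∑-distrib-+ {zero}  f g = refl
  ∑-distrib-+ {suc m} f g =
    trans (cong (λ z → (f zero + g zero) + z) (∑-distrib-+ (λ i → f (suc i)) (λ i → g (suc i))))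
          (+-interchange (f zero) (g zero) _ _)

  ∑-distribˡ-* : ∀ {m} x (f : Fin m → ℤ) → ∑ (λ i → x * f i) ≡ x * ∑ f
  ∑-distribˡ-* {zero}  x f = sym (ℤₚ.*-zeroʳ x)
  ∑-distribˡ-* {suc m} x f = trans (cong (λ z → x * f zero + z) (∑-distribˡ-* x (λ i → f (suc i))))
                                   (sym (ℤₚ.*-distribˡ-+ x (f zero) _))

  ∑-zero : ∀ m → ∑ {m} (λ _ → + 0) ≡ + 0
  ∑-zero zero    = refl
  ∑-zero (suc m) = trans (ℤₚ.+-identityˡ _) (∑-zero m)

  ∏-one : ∀ m → ∏ {m} (λ _ → + 1) ≡ + 1
  ∏-one zero    = refl
  ∏-one (suc m) = trans (ℤₚ.*-identityˡ _) (∏-one m)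

  ∑-pointMass : ∀ {m} (p : Fin m) (g : Fin m → ℤ) → (∀ i → i ≢ p → g i ≡ + 0) → ∑ g ≡ g p
  ∑-pointMass {suc m} zero g off =
    trans (cong (λ z → g zero + z) (trans (∑-cong (λ i → off (suc i) λ ())) (∑-zero m)))
          (ℤₚ.+-identityʳ (g zero))
  ∑-pointMass (suc p) g off = trans (cong (_+ ∑ (λ i → g (suc i))) (off zero λ ()))
    (trans (ℤₚ.+-identityˡ _)
           (∑-pointMass p (λ i → g (suc i)) (λ i i≢p → off (suc i) (i≢p ∘ Finₚ.suc-injective))))

  ∏-pointMass : ∀ {m} (p : Fin m) (g : Fin m → ℤ) → (∀ i → i ≢ p → g i ≡ + 1) → ∏ g ≡ g p
  ∏-pointMass {suc m} zero g off =
    trans (cong (g zero *_) (trans (∏-cong (λ i → off (suc i) λ ())) (∏-one m)))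
          (ℤₚ.*-identityʳ (g zero))
  ∏-pointMass (suc p) g off = trans (cong (_* ∏ (λ i → g (suc i))) (off zero λ ()))
    (trans (ℤₚ.*-identityˡ _)
           (∏-pointMass p (λ i → g (suc i)) (λ i i≢p → off (suc i) (i≢p ∘ Finₚ.suc-injective))))

  unitExp-diag : ∀ {m} (i : Fin m) → unitExp i i ≡ 1
  unitExp-diag i with i Fin.≟ i
  ... | yes _   = refl
  ... | no i≢i = ⊥-elim (i≢i refl)

  unitExp-off : ∀ {m} (i j : Fin m) → j ≢ i → unitExp i j ≡ 0
  unitExp-off i j j≢i with i Fin.≟ j
  ... | yes i≡j = ⊥-elim (j≢i (sym i≡j))
  ... | no _    = refl

  eval-Red : ∀ {n} (P : Poly n) (y : Fin (k P) → ℤ) → eval (Red P) y ≡ ∑ (λ i → coeff P i * y i)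
  eval-Red P y = ∑-cong λ i → cong (coeff P i *_) (begin
    ∏ (λ j → y j ^ unitExp i j) ≡⟨ ∏-pointMass i _ (λ j j≢i → cong (y j ^_) (unitExp-off i j j≢i)) ⟩
    y i ^ unitExp i i           ≡⟨ cong (y i ^_) (unitExp-diag i) ⟩
    y i * + 1                   ≡⟨ ℤₚ.*-identityʳ (y i) ⟩
    y i                         ∎)
    where open ≡-Reasoning

  MonochromaticSolution : ∀ {m r} → (Fin m → ℤ) → Colouring r → Set
  MonochromaticSolution {m} {r} a c =
    Σ (Fin m → ℕ) λ y → ((∀ i → y i ≢ 0)
           × (Σ (Fin r) λ col → (∀ i → c (y i) ≡ col))
           × ∑ (λ i → a i * + y i) ≡ + 0)

  LinearPartitionRegular : ∀ {m} → (Fin m → ℤ) → Set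
  LinearPartitionRegular a = ∀ r (c : Colouring r) → MonochromaticSolution a c

  Red-partitionRegular : ∀ {n} (P : Poly n) → LinearPartitionRegular (coeff P) → PartitionRegular (Red P)
  Red-partitionRegular P regular r c with regular r c
  ... | y , nonzero , coloured , solves =
    y , nonzero , coloured , trans (eval-Red P (λ i → + y i)) solves

  no-terms-partitionRegular : ∀ {m} (a : Fin m → ℤ) → m ≡ 0 → LinearPartitionRegular a
  no-terms-partitionRegular a refl r c = (λ ()) , (λ ()) , (c 1 , λ ()) , refl

  select : Bool → ℤ → ℤ
  select b x = if b then x else + 0

  record VanishingSubsum {m} (a : Fin m → ℤ) : Set where
    field
      S        : Fin m → Bool
      pivot    : Fin m
      pivot∈S  : S pivot ≡ true
      pivot≢0  : a pivot ≢ + 0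
      vanishes : ∑ (λ i → select (S i) (a i)) ≡ + 0

  assign : (isPivot inS : Bool) (u v w : ℕ) → ℕ
  assign isPivot inS u v w = if isPivot then u else if inS then v else w

  assign-preserves : ∀ (Q : ℕ → Set) isPivot inS {u v w} → Q u → Q v → Q w → Q (assign isPivot inS u v w)
  assign-preserves Q true  _     qu qv qw = qu
  assign-preserves Q false true  qu qv qw = qv
  assign-preserves Q false false qu qv qw = qw

  assign-term : ∀ isPivot inS a u v w → (isPivot ≡ true → inS ≡ true) →
    a * + assign isPivot inS u v w ≡
    + v * select inS a + (+ u - + v) * select isPivot a + + w * select (not inS) a
  assign-term true  true  a u v w _ = pivot-term a (+ u) (+ v) (+ w)
    where
    pivot-term : ∀ a u v w → a * u ≡ v * a + (u - v) * a + w * + 0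
    pivot-term = solve-∀
  assign-term true  false a u v w pivot∈S with pivot∈S refl
  ... | ()
  assign-term false true  a u v w _ = inside-term a (+ u) (+ v) (+ w)
    where
    inside-term : ∀ a u v w → a * v ≡ v * a + (u - v) * + 0 + w * + 0
    inside-term = solve-∀
  assign-term false false a u v w _ = outside-term a (+ u) (+ v) (+ w)
    where
    outside-term : ∀ a u v w → a * w ≡ v * + 0 + (u - v) * + 0 + w * a
    outside-term = solve-∀

  module _ {m} {a : Fin m → ℤ} (V : VanishingSubsum a) where
    open VanishingSubsum V

    complement : ℤ
    complement = ∑ (λ i → select (not (S i)) (a i))

    isPivot : Fin m → Bool
    isPivot i = does (i Fin.≟ pivot)

    ∑-select-pivot : ∑ (λ i → select (isPivot i) (a i)) ≡ a pivot
    ∑-select-pivot = trans (∑-pointMass pivot _ off) (cong (λ b → select b (a pivot)) on)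
      where
      off : ∀ i → i ≢ pivot → select (isPivot i) (a i) ≡ + 0
      off i i≢p with i Fin.≟ pivot
      ... | yes i≡p = ⊥-elim (i≢p i≡p)
      ... | no _    = refl
      on : isPivot pivot ≡ true
      on with pivot Fin.≟ pivot
      ... | yes _   = refl
      ... | no p≢p = ⊥-elim (p≢p refl)

    -- y is u at the pivot, v elsewhere on S and w off S, so only (u - v) a pivot + w complement remains.
    assignment-sum : ∀ u v w →
      ∑ (λ i → a i * + assign (isPivot i) (S i) u v w) ≡ (+ u - + v) * a pivot + + w * complement
    assignment-sum u v w = begin
      ∑ (λ i → a i * + assign (isPivot i) (S i) u v w)
        ≡⟨ ∑-cong (λ i → assign-term (isPivot i) (S i) (a i) u v w (in-S i)) ⟩
      ∑ (λ i → (inS i + atPivot i) + off i)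
        ≡⟨ ∑-distrib-+ (λ i → inS i + atPivot i) off ⟩
      ∑ (λ i → inS i + atPivot i) + ∑ off
        ≡⟨ cong₂ _+_ (∑-distrib-+ inS atPivot) (∑-distribˡ-* (+ w) (λ i → select (not (S i)) (a i))) ⟩
      (∑ inS + ∑ atPivot) + + w * complement
        ≡⟨ cong (λ z → z + + w * complement)
                (cong₂ _+_ (∑-distribˡ-* (+ v) (λ i → select (S i) (a i)))
                           (∑-distribˡ-* (+ u - + v) (λ i → select (isPivot i) (a i)))) ⟩
      (+ v * ΣS + (+ u - + v) * Σpivot) + + w * complement
        ≡⟨ cong₂ (λ s t → (+ v * s + (+ u - + v) * t) + + w * complement) vanishes ∑-select-pivot ⟩
      (+ v * + 0 + (+ u - + v) * a pivot) + + w * complement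
        ≡⟨ cong (λ z → (z + (+ u - + v) * a pivot) + + w * complement) (ℤₚ.*-zeroʳ (+ v)) ⟩
      (+ 0 + (+ u - + v) * a pivot) + + w * complement
        ≡⟨ cong (λ z → z + + w * complement) (ℤₚ.+-identityˡ ((+ u - + v) * a pivot)) ⟩
      (+ u - + v) * a pivot + + w * complement ∎
      where
      open ≡-Reasoning
      ΣS Σpivot : ℤ
      ΣS     = ∑ (λ i → select (S i) (a i))
      Σpivot = ∑ (λ i → select (isPivot i) (a i))
      inS atPivot off : Fin m → ℤ
      inS i     = + v * select (S i) (a i)
      atPivot i = (+ u - + v) * select (isPivot i) (a i)
      off i     = + w * select (not (S i)) (a i)
      in-S : ∀ i → isPivot i ≡ true → S i ≡ true
      in-S i isP with i Fin.≟ pivot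
      in-S i refl | yes refl = pivot∈S

    assignedSolution : ∀ {r} (c : Colouring r) {u v w} → u ≢ 0 → v ≢ 0 → w ≢ 0 →
                       c v ≡ c u → c w ≡ c u → (+ u - + v) * a pivot + + w * complement ≡ + 0 →
                       MonochromaticSolution a c
    assignedSolution c {u} {v} {w} u≢0 v≢0 w≢0 cv cw balanced =
      y , (λ i → assign-preserves (_≢ 0) (isPivot i) (S i) u≢0 v≢0 w≢0)
        , (c u , λ i → assign-preserves (λ z → c z ≡ c u) (isPivot i) (S i) refl cv cw)
        , trans (assignment-sum u v w) balanced
      where
      y : Fin m → ℕ
      y i = assign (isPivot i) (S i) u v w

  sign-alignment : ∀ a A → a ≢ + 0 → A ≢ + 0 →
                   a * + ∣ A ∣ ≡ A * + ∣ a ∣ ⊎ a * + ∣ A ∣ ≡ - (A * + ∣ a ∣)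
  sign-alignment (+ zero)  A         a≢0 _   = ⊥-elim (a≢0 refl)
  sign-alignment a         (+ zero)  _   A≢0 = ⊥-elim (A≢0 refl)
  sign-alignment (+ suc p) (+ suc q) _   _   = inj₁ (ℤₚ.*-comm (+ suc p) (+ suc q))
  sign-alignment (+ suc p) -[1+ q ]  _   _   = inj₂ (flip (+ suc p) (+ suc q))
    where
    flip : ∀ x y → x * y ≡ - ((- y) * x)
    flip = solve-∀
  sign-alignment -[1+ p ]  (+ suc q) _   _   = inj₂ (flip (+ suc q) (+ suc p))
    where
    flip : ∀ x y → (- y) * x ≡ - (x * y)
    flip = solve-∀
  sign-alignment -[1+ p ]  -[1+ q ]  _   _   = inj₁ (flip (+ suc q) (+ suc p))
    where
    flip : ∀ x y → (- y) * x ≡ (- x) * y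
    flip = solve-∀

  -- With L = ∣ A ∣ and M = ∣ a ∣, one of (u , v) = (x , x + L d) and (x + L d , x) makes
  -- (u - v) a + M d A vanish, according as a and A have equal or opposite signs.
  balance : ∀ a A (x d : ℕ) → a ≢ + 0 → A ≢ + 0 →
    (+ x - + (x ℕ.+ ∣ A ∣ ℕ.* d)) * a + + (∣ a ∣ ℕ.* d) * A ≡ + 0 ⊎
    (+ (x ℕ.+ ∣ A ∣ ℕ.* d) - + x) * a + + (∣ a ∣ ℕ.* d) * A ≡ + 0
  balance a A x d a≢0 A≢0 =
    Sum.map (λ same → trans (cong₂ (λ y z → (+ x - y) * a + z * A) cast-y cast-w) (same-case same))
            (λ opposite → trans (cong₂ (λ y z → (y - + x) * a + z * A) cast-y cast-w) (opposite-case opposite))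
            (sign-alignment a A a≢0 A≢0)
    where
    open ≡-Reasoning
    L M : ℕ
    L = ∣ A ∣
    M = ∣ a ∣
    cast-y : + (x ℕ.+ L ℕ.* d) ≡ + x + + L * + d
    cast-y = trans (ℤₚ.pos-+ x (L ℕ.* d)) (cong (λ z → + x + z) (ℤₚ.pos-* L d))
    cast-w : + (M ℕ.* d) ≡ + M * + d
    cast-w = ℤₚ.pos-* M d
    same-identity : ∀ x L d a M A → (x - (x + L * d)) * a + (M * d) * A ≡ d * (A * M - a * L)
    same-identity = solve-∀
    opposite-identity : ∀ x L d a M A → ((x + L * d) - x) * a + (M * d) * A ≡ d * (a * L + A * M)
    opposite-identity = solve-∀
    same-case : a * + L ≡ A * + M → (+ x - (+ x + + L * + d)) * a + (+ M * + d) * A ≡ + 0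
    same-case same = begin
      (+ x - (+ x + + L * + d)) * a + (+ M * + d) * A ≡⟨ same-identity (+ x) (+ L) (+ d) a (+ M) A ⟩
      + d * (A * + M - a * + L)                       ≡⟨ cong (λ z → + d * (A * + M - z)) same ⟩
      + d * (A * + M - A * + M)                       ≡⟨ cong (+ d *_) (ℤₚ.+-inverseʳ (A * + M)) ⟩
      + d * + 0                                       ≡⟨ ℤₚ.*-zeroʳ (+ d) ⟩
      + 0                                             ∎
    opposite-case : a * + L ≡ - (A * + M) → ((+ x + + L * + d) - + x) * a + (+ M * + d) * A ≡ + 0
    opposite-case opposite = begin
      ((+ x + + L * + d) - + x) * a + (+ M * + d) * A ≡⟨ opposite-identity (+ x) (+ L) (+ d) a (+ M) A ⟩
      + d * (a * + L + A * + M)                       ≡⟨ cong (λ z → + d * (z + A * + M)) opposite ⟩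
      + d * (- (A * + M) + A * + M)                   ≡⟨ cong (+ d *_) (ℤₚ.+-inverseˡ (A * + M)) ⟩
      + d * + 0                                       ≡⟨ ℤₚ.*-zeroʳ (+ d) ⟩
      + 0                                             ∎

  module _ {m} {a : Fin m → ℤ} (V : VanishingSubsum a) {r} (c : Colouring (suc r))
           (A≢0 : complement V ≢ + 0) where
    open VanishingSubsum V

    M≥1 : 1 ℕ.≤ ∣ a pivot ∣
    M≥1 = ℕₚ.n≢0⇒n>0 (pivot≢0 ∘ ℤₚ.∣i∣≡0⇒i≡0)

    open RadoTriple (proj₂ (radoTriples ∣ complement V ∣ ∣ a pivot ∣ M≥1 r) c)

    solutionFromTriple : MonochromaticSolution a c
    solutionFromTriple =
      [ assignedSolution V c x≢0 x+Ld≢0 Md≢0 colour-x+Ld colour-Md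
      , assignedSolution V c x+Ld≢0 x≢0 Md≢0 (sym colour-x+Ld) (trans colour-Md (sym colour-x+Ld))
      ]′ (balance (a pivot) (complement V) x d pivot≢0 A≢0)
      where
      x≢0 : x ≢ 0
      x≢0 = ℕₚ.n>0⇒n≢0 x≥1
      x+Ld≢0 : x ℕ.+ ∣ complement V ∣ ℕ.* d ≢ 0
      x+Ld≢0 = ℕₚ.n>0⇒n≢0 (ℕₚ.≤-trans x≥1 (ℕₚ.m≤m+n x _))
      Md≢0 : ∣ a pivot ∣ ℕ.* d ≢ 0
      Md≢0 = ℕₚ.n>0⇒n≢0 (ℕₚ.*-mono-≤ M≥1 d≥1)

  vanishingSubsum⇒partitionRegular : ∀ {m} {a : Fin m → ℤ} → VanishingSubsum a → LinearPartitionRegular a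
  vanishingSubsum⇒partitionRegular V zero    c = ⊥-elim (Finₚ.¬Fin0 (c 1))
  vanishingSubsum⇒partitionRegular {a = a} V (suc r) c with complement V ℤₚ.≟ + 0
  ... | yes A≡0 = assignedSolution V c one≢0 one≢0 one≢0 refl refl
                    (cong (λ z → (+ 1 - + 1) * a (VanishingSubsum.pivot V) + + 1 * z) A≡0)
    where
    one≢0 : 1 ≢ 0
    one≢0 ()
  ... | no A≢0 = solutionFromTriple V c A≢0

module PAdicDigits where

  open import Data.Nat
  open import Data.Nat.Properties
  open import Data.Nat.DivMod
  open import Data.Nat.Divisibility
  open import Data.Nat.Primality
  open import Data.Nat.Primality.Factorisation using (factorise)
  open import Data.Nat.Induction using (<-rec)
  open import Data.Nat.ListAction using (product)
  open import Data.List using ([]; _∷_)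
  open import Data.List.Relation.Unary.All using (_∷_)
  open import Data.Fin using (Fin; toℕ; fromℕ<)
  import Data.Fin.Properties as Finₚ
  open import Data.Product
  open import Data.Empty using (⊥-elim)
  open import Relation.Nullary using (¬_)
  open import Relation.Binary.PropositionalEquality

  -- Euclid: a prime factor of B! + 1 exceeds B.
  prime-above : ∀ B → ∃[ p ] Prime p × B < p
  prime-above B with factorise (suc (B !))
  ... | record { factors = [] ; isFactorisation = eq } =
    ⊥-elim (<-irrefl refl (≤-trans (s≤s (1≤n! B)) (≤-reflexive eq)))
  ... | record { factors = p ∷ ps ; isFactorisation = eq ; factorsPrime = p-prime ∷ _ } =
    p , p-prime , ≰⇒> p≰B
    where
    p∣B!+1 : p ∣ B ! + 1
    p∣B!+1 = divides (product ps) (trans (+-comm (B !) 1) (trans eq (*-comm p (product ps))))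
    n∣n! : ∀ {n} → Prime n → n ∣ n !
    n∣n! {suc n} _ = m∣m*n (n !)
    p≰B : ¬ p ≤ B
    p≰B p≤B = ¬prime[1] (subst Prime p≡1 p-prime)
      where
      p≡1 : p ≡ 1
      p≡1 = ∣1⇒≡1 (∣m+n∣m⇒∣n p∣B!+1 (∣-trans (n∣n! p-prime) (m≤n⇒m!∣n! p≤B)))

  record LowestDigitForm (p t : ℕ) : Set where
    constructor digitForm
    field
      exponent digit rest : ℕ
      digit≢0             : digit ≢ 0
      digit<p             : digit < p
      decomposition       : t ≡ p ^ exponent * (digit + p * rest)

  module LowestDigit (p : ℕ) .{{_ : NonTrivial p}} where

    instance
      p-nonZero : NonZero p
      p-nonZero = nonTrivial⇒nonZero p

    lowestDigitForm : ∀ t → LowestDigitForm p (suc t)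
    lowestDigitForm = <-rec (λ t → LowestDigitForm p (suc t)) step
      where
      step : ∀ t → (∀ {s} → s < t → LowestDigitForm p (suc s)) → LowestDigitForm p (suc t)
      step t rec with suc t % p in r-eq
      ... | suc r = digitForm 0 (suc r) (suc t / p) (λ ()) (subst (_< p) r-eq (m%n<n (suc t) p)) (begin
        suc t                       ≡⟨ m≡m%n+[m/n]*n (suc t) p ⟩
        suc t % p + suc t / p * p   ≡⟨ cong₂ (λ x y → x + y) r-eq (*-comm (suc t / p) p) ⟩
        suc r + p * (suc t / p)     ≡⟨ *-identityˡ _ ⟨
        1 * (suc r + p * (suc t / p)) ∎)
        where open ≡-Reasoning
      ... | zero with suc t / p in q-eq
      ...   | zero = ⊥-elim (1+n≢0 (trans (m≡m%n+[m/n]*n (suc t) p) (cong₂ (λ x y → x + y * p) r-eq q-eq)))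
      ...   | suc s = digitForm (suc e) δ ρ δ≢0 δ<p (begin
        suc t                   ≡⟨ m≡m%n+[m/n]*n (suc t) p ⟩
        suc t % p + suc t / p * p ≡⟨ cong₂ (λ x y → x + y * p) r-eq q-eq ⟩
        suc s * p               ≡⟨ *-comm (suc s) p ⟩
        p * suc s               ≡⟨ cong (p *_) eq ⟩
        p * (p ^ e * (δ + p * ρ)) ≡⟨ *-assoc p (p ^ e) _ ⟨
        p ^ suc e * (δ + p * ρ) ∎)
        where
        open ≡-Reasoning
        s<t : s < t
        s<t = s≤s⁻¹ (subst (_< suc t) q-eq (m/n<m (suc t) p (nonTrivial⇒n>1 p)))
        open LowestDigitForm (rec s<t) renaming (exponent to e; digit to δ; rest to ρ; digit≢0 to δ≢0;
                                                   digit<p to δ<p; decomposition to eq)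

    -- The colour of 0 is junk.
    lowestDigit : ℕ → Fin p
    lowestDigit zero    = fromℕ< (>-nonZero⁻¹ p)
    lowestDigit (suc t) = fromℕ< (LowestDigitForm.digit<p (lowestDigitForm t))

    lowestDigit-form : ∀ {x} → x ≢ 0 →
                       Σ (LowestDigitForm p x) λ F → LowestDigitForm.digit F ≡ toℕ (lowestDigit x)
    lowestDigit-form {zero} x≢0 = ⊥-elim (x≢0 refl)
    lowestDigit-form {suc t} _  = lowestDigitForm t , sym (Finₚ.toℕ-fromℕ< _)

module Valuations where

  open import Data.Nat as ℕ using (ℕ; zero; suc)
  import Data.Nat.Properties as ℕₚ
  open import Data.Nat.Divisibility as ℕᵈ using (divides)
  open import Data.Nat.Coprimality using (Coprime; coprime-divisor)
  open import Data.Integer as ℤ using (ℤ; +_; _+_; _*_; -_; ∣_∣; _^_)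
  import Data.Integer.Properties as ℤₚ
  open import Data.Integer.Tactic.RingSolver using (solve-∀)
  open import Data.Fin using (Fin; zero; suc)
  open import Data.Bool using (Bool; true; false; T)
  open import Data.Product
  open import Data.Sum using (inj₁; inj₂)
  open import Data.Empty using (⊥-elim)
  open import Relation.Binary.PropositionalEquality
  open import Function using (_∘_)
  open import Algebra.Properties.AbelianGroup ℤₚ.+-0-abelianGroup using (inverseˡ-unique)
  open LinearEquations using (∑-cong; ∑-distrib-+; ∑-distribˡ-*; select)

  pos-^ : ∀ m e → + (m ℕ.^ e) ≡ (+ m) ^ e
  pos-^ m zero    = refl
  pos-^ m (suc e) = trans (ℤₚ.pos-* m (m ℕ.^ e)) (cong (+ m *_) (pos-^ m e))

  -- For p prime to δ: X has p-adic valuation V and unit part congruent to δ ^ e modulo p.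
  record ValuationForm (p δ X : ℤ) (V e : ℕ) : Set where
    constructor _,_
    field
      cofactor : ℤ
      form     : X ≡ p ^ V * (δ ^ e + p * cofactor)

  module _ {p δ : ℤ} where

    valuationForm-one : ValuationForm p δ (+ 1) 0 0
    valuationForm-one = + 0 , unit-identity p
      where
      unit-identity : ∀ p → + 1 ≡ + 1 * (+ 1 + p * + 0)
      unit-identity = solve-∀

    valuationForm-* : ∀ {X Y V W e f} → ValuationForm p δ X V e → ValuationForm p δ Y W f →
                      ValuationForm p δ (X * Y) (V ℕ.+ W) (e ℕ.+ f)
    valuationForm-* {X} {Y} {V} {W} {e} {f} (u , X≡) (w , Y≡) =
      δ ^ e * w + u * δ ^ f + p * u * w , (begin
      X * Y                                                     ≡⟨ cong₂ _*_ X≡ Y≡ ⟩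
      p ^ V * (δ ^ e + p * u) * (p ^ W * (δ ^ f + p * w))       ≡⟨ expand (p ^ V) (p ^ W) (δ ^ e) (δ ^ f) p u w ⟩
      p ^ V * p ^ W * (δ ^ e * δ ^ f + p * (δ ^ e * w + u * δ ^ f + p * u * w))
        ≡⟨ cong₂ (λ P D → P * (D + p * (δ ^ e * w + u * δ ^ f + p * u * w)))
                 (ℤₚ.^-distribˡ-+-* p V W) (ℤₚ.^-distribˡ-+-* δ e f) ⟨
      p ^ (V ℕ.+ W) * (δ ^ (e ℕ.+ f) + p * (δ ^ e * w + u * δ ^ f + p * u * w)) ∎)
      where
      open ≡-Reasoning
      expand : ∀ P Q D E p u w → P * (D + p * u) * (Q * (E + p * w)) ≡
                                 P * Q * (D * E + p * (D * w + u * E + p * u * w))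
      expand = solve-∀

    valuationForm-^ : ∀ {X V} → ValuationForm p δ X V 1 → ∀ e → ValuationForm p δ (X ^ e) (V ℕ.* e) e
    valuationForm-^ {V = V} F zero    = subst (λ W → ValuationForm p δ (+ 1) W 0) (sym (ℕₚ.*-zeroʳ V))
                                              valuationForm-one
    valuationForm-^ {X} {V} F (suc e) =
      subst (λ W → ValuationForm p δ (X ^ suc e) W (suc e)) (sym (ℕₚ.*-suc V e))
            (valuationForm-* F (valuationForm-^ F e))

    valuationForm-∏ : ∀ {m} (x : Fin m → ℤ) (v e : Fin m → ℕ) → (∀ j → ValuationForm p δ (x j) (v j) 1) →
                      ValuationForm p δ (∏ (λ j → x j ^ e j)) (∑ℕ (λ j → v j ℕ.* e j)) (∑ℕ e)
    valuationForm-∏ {zero}  x v e F = valuationForm-one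
    valuationForm-∏ {suc m} x v e F = valuationForm-* (valuationForm-^ (F zero) (e zero))
      (valuationForm-∏ (λ j → x (suc j)) (λ j → v (suc j)) (λ j → e (suc j)) (λ j → F (suc j)))

  valuation-split : ∀ (P D a w : ℤ) {V₀ V} → V₀ ℕ.≤ V →
    ∃[ z ] a * (P ^ V * (D + P * w)) ≡ P ^ V₀ * (D * select (V ℕ.≡ᵇ V₀) a + P * z)
  valuation-split P D a w {V₀} {V} V₀≤V with V ℕ.≡ᵇ V₀ in V≡ᵇV₀
  ... | true = a * w , trans (cong (λ n → a * (P ^ n * (D + P * w))) V≡V₀) (minimal a (P ^ V₀) D P w)
    where
    V≡V₀ : V ≡ V₀
    V≡V₀ = ℕₚ.≡ᵇ⇒≡ V V₀ (subst T (sym V≡ᵇV₀) _)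
    minimal : ∀ a Q D P w → a * (Q * (D + P * w)) ≡ Q * (D * a + P * (a * w))
    minimal = solve-∀
  ... | false = a * P ^ t * (D + P * w) , trans (cong (λ Q → a * (Q * (D + P * w))) split)
                                                (higher a (P ^ V₀) D P (P ^ t) w)
    where
    V≢V₀ : V ≢ V₀
    V≢V₀ V≡V₀ = subst T V≡ᵇV₀ (ℕₚ.≡⇒≡ᵇ V V₀ V≡V₀)
    t : ℕ
    t = V ℕ.∸ suc V₀
    split : P ^ V ≡ P ^ V₀ * (P * P ^ t)
    split = trans (cong (P ^_) (trans (sym (ℕₚ.m+[n∸m]≡n (ℕₚ.≤∧≢⇒< V₀≤V (V≢V₀ ∘ sym))))
                                      (sym (ℕₚ.+-suc V₀ t))))
                  (ℤₚ.^-distribˡ-+-* P V₀ (suc t))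
    higher : ∀ a Q D P T w → a * (Q * (P * T) * (D + P * w)) ≡ Q * (D * + 0 + P * (a * T * (D + P * w)))
    higher = solve-∀

  -- Dividing the vanishing sum by p ^ V₀, every term of valuation above V₀ is a multiple of p.
  minimal-valuation-terms : ∀ {m} (p : ℕ) (D : ℤ) (a : Fin m → ℤ) (V : Fin m → ℕ) (w : Fin m → ℤ) (V₀ : ℕ) →
    p ≢ 0 → (∀ i → V₀ ℕ.≤ V i) → ∑ (λ i → a i * ((+ p) ^ V i * (D + + p * w i))) ≡ + 0 →
    ∃[ z ] D * ∑ (λ i → select (V i ℕ.≡ᵇ V₀) (a i)) + + p * z ≡ + 0
  minimal-valuation-terms {m} p D a V w V₀ p≢0 V₀≤ vanishes = ∑ z , reduced
    where
    P : ℤ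
    P = + p
    term : ∀ i → ∃[ z ] a i * (P ^ V i * (D + P * w i)) ≡
                        P ^ V₀ * (D * select (V i ℕ.≡ᵇ V₀) (a i) + P * z)
    term i = valuation-split P D (a i) (w i) (V₀≤ i)
    z : Fin m → ℤ
    z i = proj₁ (term i)
    S : Fin m → Bool
    S i = V i ℕ.≡ᵇ V₀
    factored : P ^ V₀ * (D * ∑ (λ i → select (S i) (a i)) + P * ∑ z) ≡ + 0
    factored = begin
      P ^ V₀ * (D * ∑ (λ i → select (S i) (a i)) + P * ∑ z)
        ≡⟨ cong (P ^ V₀ *_) (cong₂ _+_ (∑-distribˡ-* D (λ i → select (S i) (a i))) (∑-distribˡ-* P z)) ⟨
      P ^ V₀ * (∑ (λ i → D * select (S i) (a i)) + ∑ (λ i → P * z i))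
        ≡⟨ cong (P ^ V₀ *_) (∑-distrib-+ (λ i → D * select (S i) (a i)) (λ i → P * z i)) ⟨
      P ^ V₀ * ∑ (λ i → D * select (S i) (a i) + P * z i)
        ≡⟨ ∑-distribˡ-* (P ^ V₀) (λ i → D * select (S i) (a i) + P * z i) ⟨
      ∑ (λ i → P ^ V₀ * (D * select (S i) (a i) + P * z i))
        ≡⟨ ∑-cong (λ i → proj₂ (term i)) ⟨
      ∑ (λ i → a i * (P ^ V i * (D + P * w i)))
        ≡⟨ vanishes ⟩
      + 0 ∎
      where open ≡-Reasoning
    reduced : D * ∑ (λ i → select (S i) (a i)) + P * ∑ z ≡ + 0
    reduced with ℤₚ.i*j≡0⇒i≡0∨j≡0 (P ^ V₀) factored
    ... | inj₁ P^V₀≡0 = ⊥-elim (p≢0 (ℤₚ.+-injective (ℤₚ.i^n≡0⇒i≡0 P V₀ P^V₀≡0)))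
    ... | inj₂ eq     = eq

  coprime-^-divisor : ∀ {p δ t} → Coprime p δ → ∀ d → p ℕᵈ.∣ δ ℕ.^ d ℕ.* t → p ℕᵈ.∣ t
  coprime-^-divisor {p} {δ} {t} coprime zero    p∣ = subst (p ℕᵈ.∣_) (ℕₚ.+-identityʳ t) p∣
  coprime-^-divisor {p} {δ} {t} coprime (suc d) p∣ =
    coprime-^-divisor coprime d (coprime-divisor coprime (subst (p ℕᵈ.∣_) (ℕₚ.*-assoc δ (δ ℕ.^ d) t) p∣))

  coprime-small-vanishes : ∀ {p δ} → Coprime p δ → ∀ d s z → (+ δ) ^ d * s + + p * z ≡ + 0 →
                           ∣ s ∣ ℕ.< p → s ≡ + 0
  coprime-small-vanishes {p} {δ} coprime d s z eq ∣s∣<p = ℤₚ.∣i∣≡0⇒i≡0 (small ∣s∣<p p∣s)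
    where
    p∣s : p ℕᵈ.∣ ∣ s ∣
    p∣s = coprime-^-divisor coprime d (divides ∣ z ∣ (begin
      δ ℕ.^ d ℕ.* ∣ s ∣      ≡⟨ cong (ℕ._* ∣ s ∣) (cong ∣_∣ (pos-^ δ d)) ⟩
      ∣ (+ δ) ^ d ∣ ℕ.* ∣ s ∣ ≡⟨ ℤₚ.abs-* ((+ δ) ^ d) s ⟨
      ∣ (+ δ) ^ d * s ∣      ≡⟨ cong ∣_∣ (inverseˡ-unique ((+ δ) ^ d * s) (+ p * z) eq) ⟩
      ∣ - (+ p * z) ∣        ≡⟨ ℤₚ.∣-i∣≡∣i∣ (+ p * z) ⟩
      ∣ + p * z ∣            ≡⟨ ℤₚ.abs-* (+ p) z ⟩
      p ℕ.* ∣ z ∣            ≡⟨ ℕₚ.*-comm p ∣ z ∣ ⟩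
      ∣ z ∣ ℕ.* p            ∎))
      where open ≡-Reasoning
    small : ∀ {n} → n ℕ.< p → p ℕᵈ.∣ n → n ≡ 0
    small {zero}  _   _   = refl
    small {suc n} n<p p∣n = ⊥-elim (ℕᵈ.>⇒∤ n<p p∣n)

module HomogeneousPolynomials where

  open import Data.Nat as ℕ using (ℕ; zero; suc; z≤n; NonTrivial)
  import Data.Nat.Properties as ℕₚ
  open import Data.Nat.Coprimality using (Coprime; prime⇒coprime)
  open import Data.Nat.Primality using (Prime; prime)
  open import Data.Integer as ℤ using (ℤ; +_; _+_; _*_; ∣_∣; _^_)
  import Data.Integer.Properties as ℤₚ
  open import Data.Fin using (Fin; zero; suc; toℕ)
  import Data.Fin.Properties as Finₚ
  open import Data.Bool using (Bool; true; false)
  import Data.Bool.Properties as Boolₚ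
  open import Data.Product
  open import Function using (_∘_; Equivalence)
  open import Relation.Nullary using (yes; no)
  open import Relation.Binary.PropositionalEquality
  open LinearEquations
  open PAdicDigits
  open Valuations

  minimum-index : ∀ {m} → Fin m → (V : Fin m → ℕ) → ∃[ i₀ ] ∀ i → V i₀ ℕ.≤ V i
  minimum-index {suc zero}    _ V = zero , λ { zero → ℕₚ.≤-refl }
  minimum-index {suc (suc m)} _ V with minimum-index {suc m} zero (V ∘ suc)
  ... | j , min with V zero ℕₚ.≤? V (suc j)
  ...   | yes le = zero , λ { zero → ℕₚ.≤-refl ; (suc i) → ℕₚ.≤-trans le (min i) }
  ...   | no  gt = suc j , λ { zero → ℕₚ.<⇒≤ (ℕₚ.≰⇒> gt) ; (suc i) → min i }

  ∣∑-select∣≤∑∣∣ : ∀ {m} (S : Fin m → Bool) (a : Fin m → ℤ) →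
                   ∣ ∑ (λ i → select (S i) (a i)) ∣ ℕ.≤ ∑ℕ (λ i → ∣ a i ∣)
  ∣∑-select∣≤∑∣∣ {zero}  S a = z≤n
  ∣∑-select∣≤∑∣∣ {suc m} S a = ℕₚ.≤-trans (ℤₚ.∣i+j∣≤∣i∣+∣j∣ (select (S zero) (a zero)) _)
    (ℕₚ.+-mono-≤ (∣select∣≤∣∣ (S zero)) (∣∑-select∣≤∑∣∣ (S ∘ suc) (a ∘ suc)))
    where
    ∣select∣≤∣∣ : ∀ b → ∣ select b (a zero) ∣ ℕ.≤ ∣ a zero ∣
    ∣select∣≤∣∣ true  = ℕₚ.≤-refl
    ∣select∣≤∣∣ false = z≤n

  variable-form : ∀ {p δ x} (F : LowestDigitForm p x) → LowestDigitForm.digit F ≡ δ →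
                  ValuationForm (+ p) (+ δ) (+ x) (LowestDigitForm.exponent F) 1
  variable-form {p} {x = x} (digitForm v δ q _ _ x≡) refl = + q , (begin
    + x                                    ≡⟨ cong +_ x≡ ⟩
    + (p ℕ.^ v ℕ.* (δ ℕ.+ p ℕ.* q))         ≡⟨ ℤₚ.pos-* (p ℕ.^ v) _ ⟩
    + (p ℕ.^ v) * + (δ ℕ.+ p ℕ.* q)         ≡⟨ cong₂ _*_ (pos-^ p v) (ℤₚ.pos-+ δ (p ℕ.* q)) ⟩
    (+ p) ^ v * (+ δ + + (p ℕ.* q))         ≡⟨ cong (λ u → (+ p) ^ v * (+ δ + u)) (ℤₚ.pos-* p q) ⟩
    (+ p) ^ v * (+ δ + + p * + q)           ≡⟨ cong (λ u → (+ p) ^ v * (u + + p * + q)) (ℤₚ.^-identityʳ (+ δ)) ⟨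
    (+ p) ^ v * ((+ δ) ^ 1 + + p * + q)     ∎)
    where open ≡-Reasoning

  -- Colour by the lowest nonzero base-p digit, p a prime above ∑ ∣ a i ∣. In a monochromatic solution
  -- every variable is p ^ v * (δ + p q), so by homogeneity every monomial is p ^ V * (δ ^ d + p w).
  -- Reducing the equation modulo p above the least V, the coefficients of the monomials of least V
  -- sum to a multiple of p that is smaller than p.
  module HomogeneousArgument {n} (P : Poly n) (nf : NormalForm P) (d : ℕ)
    (homogeneous : ∀ i → deg (mono P i) ≡ d) (regular : PartitionRegular P) (i₀ : Fin (k P))
    (p : ℕ) .{{_ : NonTrivial p}} (p-prime : Prime p) (bound : ∑ℕ (λ i → ∣ coeff P i ∣) ℕ.< p) where

    open NormalForm nf
    open LowestDigit p

    x : Fin n → ℕ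
    x = proj₁ (regular p lowestDigit)

    x≢0 : ∀ j → x j ≢ 0
    x≢0 = proj₁ (proj₂ (regular p lowestDigit))

    colour : Fin p
    colour = proj₁ (proj₁ (proj₂ (proj₂ (regular p lowestDigit))))

    x-coloured : ∀ j → lowestDigit (x j) ≡ colour
    x-coloured = proj₂ (proj₁ (proj₂ (proj₂ (regular p lowestDigit))))

    solves : eval P (λ j → + x j) ≡ + 0
    solves = proj₂ (proj₂ (proj₂ (regular p lowestDigit)))

    δ : ℕ
    δ = toℕ colour

    digitForm-of : ∀ j → Σ (LowestDigitForm p (x j)) λ F → LowestDigitForm.digit F ≡ δ
    digitForm-of j with lowestDigit-form (x≢0 j)
    ... | F , digit≡ = F , trans digit≡ (cong toℕ (x-coloured j))

    v : Fin n → ℕ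
    v j = LowestDigitForm.exponent (proj₁ (digitForm-of j))

    V : Fin (k P) → ℕ
    V i = ∑ℕ (λ j → v j ℕ.* mono P i j)

    monomial-form : ∀ i → ValuationForm (+ p) (+ δ) (∏ (λ j → (+ x j) ^ mono P i j)) (V i) d
    monomial-form i = subst (ValuationForm (+ p) (+ δ) _ (V i)) (homogeneous i)
      (valuationForm-∏ (λ j → + x j) v (mono P i)
                       (λ j → variable-form (proj₁ (digitForm-of j)) (proj₂ (digitForm-of j))))

    i₁ : Fin (k P)
    i₁ = proj₁ (minimum-index i₀ V)

    S : Fin (k P) → Bool
    S i = V i ℕ.≡ᵇ V i₁

    reduced : ∃[ z ] (+ δ) ^ d * ∑ (λ i → select (S i) (coeff P i)) + + p * z ≡ + 0
    reduced = minimal-valuation-terms p ((+ δ) ^ d) (coeff P) V (ValuationForm.cofactor ∘ monomial-form)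
      (V i₁) (ℕ.≢-nonZero⁻¹ p) (proj₂ (minimum-index i₀ V))
      (trans (∑-cong λ i → cong (coeff P i *_) (sym (ValuationForm.form (monomial-form i)))) solves)

    δ-coprime : Coprime p δ
    δ-coprime = prime⇒coprime p-prime {{ℕ.≢-nonZero δ≢0}} (Finₚ.toℕ<n colour)
      where
      j₀ : Fin n
      j₀ = proj₁ (nonconst i₀)
      δ≢0 : δ ≢ 0
      δ≢0 = subst (_≢ 0) (proj₂ (digitForm-of j₀)) (LowestDigitForm.digit≢0 (proj₁ (digitForm-of j₀)))

    vanishingSubsum : VanishingSubsum (coeff P)
    vanishingSubsum = record
      { S        = S
      ; pivot    = i₁
      ; pivot∈S  = Equivalence.to Boolₚ.T-≡ (ℕₚ.≡⇒≡ᵇ (V i₁) (V i₁) refl)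
      ; pivot≢0  = coeff≢0 i₁
      ; vanishes = coprime-small-vanishes δ-coprime d _ (proj₁ reduced) (proj₂ reduced)
                     (ℕₚ.≤-<-trans (∣∑-select∣≤∑∣∣ S (coeff P)) bound)
      }

  homogeneous⇒vanishingSubsum : ∀ {n} (P : Poly n) → NormalForm P → Homogeneous P → PartitionRegular P →
                                Fin (k P) → VanishingSubsum (coeff P)
  homogeneous⇒vanishingSubsum P nf (d , homogeneous) regular i₀
    with prime-above (∑ℕ (λ i → ∣ coeff P i ∣))
  -- Matching on prime brings the irrelevant NonTrivial p instance into scope.
  ... | p , p-prime@(prime {{_}} _) , bound =
    HomogeneousArgument.vanishingSubsum P nf d homogeneous regular i₀ p p-prime bound

open import Data.Nat using (ℕ; zero; suc)
open import Data.Fin using (Fin; zero)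
open import Data.Sum using (_⊎_; inj₁; inj₂)
open import Relation.Binary.PropositionalEquality using (_≡_; refl)
open LinearEquations
  using (LinearPartitionRegular; Red-partitionRegular; no-terms-partitionRegular; vanishingSubsum⇒partitionRegular)
open HomogeneousPolynomials using (homogeneous⇒vanishingSubsum)

zero-or-Fin : ∀ m → m ≡ 0 ⊎ Fin m
zero-or-Fin zero    = inj₁ refl
zero-or-Fin (suc m) = inj₂ zero

theorem3p5p18 : ∀ (n : ℕ) (P : Poly n) → NormalForm P → Homogeneous P →
    PartitionRegular P → PartitionRegular (Red P)
theorem3p5p18 n P nf homogeneous regular = Red-partitionRegular P (linear (zero-or-Fin (k P)))
  where
  linear : k P ≡ 0 ⊎ Fin (k P) → LinearPartitionRegular (coeff P)
  linear (inj₁ k≡0) = no-terms-partitionRegular (coeff P) k≡0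
  linear (inj₂ i₀)  = vanishingSubsum⇒partitionRegular
                        (homogeneous⇒vanishingSubsum P nf homogeneous regular i₀)
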